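{- Let $h$ be a positive integer and let $k$ be a nonnegative integer with $s_k\le 2^h$. Let $f_{h,k}$ be the symmetric pebbling configuration on the complete binary tree $T^h$ with $f_0=2^h-s_k$ pebbles at the root and $f_i=2\varepsilon_i$ pebbles at each vertex of level $i$ for $1\le i\le h$, where $(\varepsilon_1,\varepsilon_2,\dots)$ are the $M$-digits of $k$ (padded with zeros). Then the total number of pebbles of $f_{h,k}$ is \[ n(f_{h,k})=\sum_{i=0}^h 2^if_i=2^h-k. \]
   Context: Sequence $s_n$: let $A_1=(5)$ and for $k\ge2$ let $A_k$ be the concatenation $A_{k-1},A_{k-1},(1)$; $A$ is the limiting infinite list; $a_0=0$, $a_n$ is the $n$th entry of $A$ for $n\ge1$, and $s_n=a_0+\cdots+a_n$. For $i\ge1$ let $M_i=2^i-1$. $M$-expansion of a positive integer $n$: let $\ell=\max\{i:n\ge M_i\}$ and write $n=M_\ell+r$ with $0\le r\le M_\ell$; if $r=0$ stop with $n=M_\ell$; if $r=M_\ell$ stop with $n=2M_\ell$; otherwise continue with $r$. This gives $n=\varepsilon_1M_1+\cdots+\varepsilon_\ell M_\ell$ with $\varepsilon_i\in\{0,1,2\}$; set $\varepsilon_i=0$ for $i>\ell$, and all $\varepsilon_i=0$ when $k=0$. $T^h$ is the complete binary tree of height $h$ (each non-leaf vertex has two children, all leaves at distance $h$ from the root); level $i$ consists of the $2^i$ vertices at distance $i$ from the root. A pebbling configuration assigns a nonnegative integer number of pebbles to each vertex; it is symmetric if all vertices in the same level carry the same number of pebbles, and is then written $\{f_0,f_1,\dots,f_h\}$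 with $f_i$ the number at each vertex of level $i$. -}

module Defs where

open import Data.Nat using (ℕ; zero; suc; _+_; _*_; _∸_; _^_; _≤ᵇ_; _≡ᵇ_)
open import Data.Bool using (if_then_else_)
open import Data.List using (List; []; _∷_; _++_)
open import Data.Fin using (Fin; toℕ)
import Data.Fin as F

-- A_k (indexed so that Ablock 1 = (5)); Ablock 0 = () is an auxiliary base.
Ablock : ℕ → List ℕ
Ablock zero          = []
Ablock (suc zero)    = 5 ∷ []
Ablock (suc (suc k)) = Ablock (suc k) ++ Ablock (suc k) ++ (1 ∷ [])

-- 1-indexed entry of a list, with default 0 out of range
nth : List ℕ → ℕ → ℕ
nth []       _             = 0
nth (x ∷ xs) zero          = 0
nth (x ∷ xs) (suc zero)    = x
nth (x ∷ xs) (suc (suc n)) = nth xs (suc n)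

-- a_0 = 0; a_n = n-th entry of the limit list A.  Since each A_k is a
-- prefix of A_{k+1} and |A_{n+1}| = 2^{n+1}-1 ≥ n, the n-th entry of A
-- is the n-th entry of A_{n+1}.
a : ℕ → ℕ
a zero    = 0
a (suc n) = nth (Ablock (suc (suc n))) (suc n)

s : ℕ → ℕ
s zero    = a zero
s (suc n) = s n + a (suc n)

M : ℕ → ℕ
M i = 2 ^ i ∸ 1

lev : ℕ → ℕ → ℕ
lev n zero    = 0
lev n (suc i) = if M (suc i) ≤ᵇ n then suc i else lev n i

-- ℓ(n) = max { i ≥ 1 : n ≥ M_i }  (for n ≥ 1; M_i ≥ i so i ≤ n)
ell : ℕ → ℕ
ell n = lev n n

epsF : ℕ → ℕ → ℕ → ℕ
epsF zero     _       _ = 0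
epsF (suc f)  zero    _ = 0
epsF (suc f)  (suc m) i =
  let n = suc m
      l = ell n
      r = n ∸ M l
  in if r ≡ᵇ 0 then (if i ≡ᵇ l then 1 else 0)
     else if r ≡ᵇ M l then (if i ≡ᵇ l then 2 else 0)
     else (if i ≡ᵇ l then 1 else epsF f r i)

-- ε_i(k): the M-digits of k (0 for i > ℓ, all 0 for k = 0).
-- Fuel k suffices since the remainder strictly decreases.
eps : ℕ → ℕ → ℕ
eps k i = epsF k k i

-- Complete binary tree T^h: level i (0 ≤ i ≤ h) has 2^i vertices.
-- A vertex is a pair (level i, position j < 2^i).

Config : ℕ → Set
Config h = (i : Fin (suc h)) → Fin (2 ^ toℕ i) → ℕ

sumFin : (n : ℕ) → (Fin n → ℕ) → ℕ
sumFin zero    g = 0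
sumFin (suc n) g = g F.zero + sumFin n (λ j → g (F.suc j))

total : (h : ℕ) → Config h → ℕ
total h f = sumFin (suc h) (λ i → sumFin (2 ^ toℕ i) (λ j → f i j))

symmetric : (h : ℕ) → (ℕ → ℕ) → Config h
symmetric h lv i j = lv (toℕ i)

weightedSum : ℕ → (ℕ → ℕ) → ℕ
weightedSum zero    lv = lv 0
weightedSum (suc h) lv = weightedSum h lv + 2 ^ suc h * lv (suc h)

fhkLevels : ℕ → ℕ → ℕ → ℕ
fhkLevels h k zero    = 2 ^ h ∸ s k
fhkLevels h k (suc i) = 2 * eps k (suc i)

fhk : (h k : ℕ) → Config h
fhk h k = symmetric h (fhkLevels h k)

-- The list A is self-similar: A_{l+2} = A_{l+1} A_{l+1} 1 and A_{l+1} has length M_{l+1}.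
-- Hence s(M_l + r) = s(M_l) + s(r) for r ≤ M_l, and s(M_l) = M_l + 2^{l+1} for l ≥ 1.
-- Peeling off the terms M_l of the greedy M-expansion of k one at a time gives
--   s_k = k + Σ_{i ≥ 1} 2^{i+1} ε_i(k).
-- For a symmetric configuration n(f) = Σ_i 2^i f_i, so
--   n(f_{h,k}) = (2^h - s_k) + Σ_{i=1}^h 2^{i+1} ε_i(k) = 2^h - k,
-- where s_k ≤ 2^h guarantees both that the subtraction is honest and that ℓ(k) ≤ h,
-- so that no digit is cut off.
module Submission where

open import Defs
open import Data.Bool using (true; false; T; if_then_else_)
open import Data.Empty using (⊥-elim)
open import Data.Fin using (Fin; toℕ; inject₁; fromℕ)
import Data.Fin as Fin
open import Data.Fin.Properties using (toℕ-inject₁; toℕ-fromℕ)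
open import Data.List using (List; []; _∷_; _++_; length)
open import Data.List.Properties using (length-++)
open import Data.Nat
open import Data.Nat.Properties
open import Data.Nat.Solver using (module +-*-Solver)
open import Data.Product using (_×_; _,_)
open import Data.Sum using (inj₁; inj₂)
open import Data.Unit using (tt)
open import Function using (_∘_)
open import Relation.Binary.PropositionalEquality
open +-*-Solver

suc-M : ∀ l → suc (M l) ≡ 2 ^ l
suc-M l = trans (+-comm 1 (M l)) (m∸n+n≡m (m^n>0 2 l))

M-suc : ∀ l → M (suc l) ≡ M l + suc (M l)
M-suc l = begin
  2 ^ l + (2 ^ l + 0) ∸ 1                 ≡⟨ cong (λ x → x + (x + 0) ∸ 1) (sym (suc-M l)) ⟩
  suc (M l) + (suc (M l) + 0) ∸ 1         ≡⟨ cong (M l +_) (+-identityʳ (suc (M l))) ⟩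
  M l + suc (M l)                         ∎
  where open ≡-Reasoning

M-mono : ∀ {i j} → i ≤ j → M i ≤ M j
M-mono i≤j = ∸-monoˡ-≤ 1 (^-monoʳ-≤ 2 i≤j)

n≤M : ∀ n → n ≤ M n
n≤M zero    = z≤n
n≤M (suc n) = subst (suc n ≤_) (sym (M-suc n)) (≤-trans (s≤s (n≤M n)) (m≤n+m (suc (M n)) (M n)))

nth-zero : ∀ xs → nth xs 0 ≡ 0
nth-zero []       = refl
nth-zero (x ∷ xs) = refl

nth-++ˡ : ∀ (xs ys : List ℕ) n → n ≤ length xs → nth (xs ++ ys) n ≡ nth xs n
nth-++ˡ []       ys zero          _       = nth-zero ys
nth-++ˡ (x ∷ xs) ys zero          _       = refl
nth-++ˡ (x ∷ xs) ys (suc zero)    _       = refl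
nth-++ˡ (x ∷ xs) ys (suc (suc n)) (s≤s p) = nth-++ˡ xs ys (suc n) p

nth-++ʳ : ∀ (xs ys : List ℕ) n → 1 ≤ n → nth (xs ++ ys) (length xs + n) ≡ nth ys n
nth-++ʳ []       ys n       _ = refl
nth-++ʳ (x ∷ xs) ys (suc n) p rewrite +-suc (length xs) n =
  trans (cong (nth (xs ++ ys)) (sym (+-suc (length xs) n))) (nth-++ʳ xs ys (suc n) p)

length-Ablock : ∀ l → length (Ablock l) ≡ M l
length-Ablock zero          = refl
length-Ablock (suc zero)    = refl
length-Ablock (suc (suc l)) = begin
  length (B ++ B ++ 1 ∷ [])          ≡⟨ length-++ B ⟩
  length B + length (B ++ 1 ∷ [])    ≡⟨ cong (length B +_) (length-++ B) ⟩
  length B + (length B + 1)          ≡⟨ cong (λ x → x + (x + 1)) (length-Ablock (suc l)) ⟩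
  M (suc l) + (M (suc l) + 1)        ≡⟨ cong (M (suc l) +_) (+-comm (M (suc l)) 1) ⟩
  M (suc l) + suc (M (suc l))        ≡⟨ sym (M-suc (suc l)) ⟩
  M (suc (suc l))                    ∎
  where
  open ≡-Reasoning
  B = Ablock (suc l)

nth-Ablock-suc : ∀ l {n} → n ≤ M l → nth (Ablock (suc l)) n ≡ nth (Ablock l) n
nth-Ablock-suc zero    z≤n = refl
nth-Ablock-suc (suc l) {n} n≤Ml =
  nth-++ˡ (Ablock (suc l)) _ n (subst (n ≤_) (sym (length-Ablock (suc l))) n≤Ml)

nth-Ablock-≤′ : ∀ {l l′ n} → l ≤′ l′ → n ≤ M l → nth (Ablock l′) n ≡ nth (Ablock l) n
nth-Ablock-≤′ ≤′-refl         _   = refl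
nth-Ablock-≤′ (≤′-step {l′} l≤′l′) n≤Ml =
  trans (nth-Ablock-suc l′ (≤-trans n≤Ml (M-mono (≤′⇒≤ l≤′l′)))) (nth-Ablock-≤′ l≤′l′ n≤Ml)

a-Ablock : ∀ l {n} → n ≤ M l → a n ≡ nth (Ablock l) n
a-Ablock l {zero}  _ = sym (nth-zero (Ablock l))
a-Ablock l {suc m} n≤Ml with ≤-total l (suc (suc m))
... | inj₁ l≤ = nth-Ablock-≤′ (≤⇒≤′ l≤) n≤Ml
... | inj₂ ≤l = sym (nth-Ablock-≤′ (≤⇒≤′ ≤l) (≤-trans (n≤1+n (suc m)) (n≤M (suc (suc m)))))

nth-Ablock-right : ∀ l {j} → 1 ≤ j →
  nth (Ablock (suc (suc l))) (M (suc l) + j) ≡ nth (Ablock (suc l) ++ 1 ∷ []) j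
nth-Ablock-right l {j} 1≤j =
  subst (λ L → nth (B ++ B ++ 1 ∷ []) (L + j) ≡ nth (B ++ 1 ∷ []) j)
        (length-Ablock (suc l)) (nth-++ʳ B (B ++ 1 ∷ []) j 1≤j)
  where B = Ablock (suc l)

a-shift : ∀ l {j} → 1 ≤ j → j ≤ M l → a (M l + j) ≡ a j
a-shift zero    (s≤s _) ()
a-shift (suc l) {j} 1≤j j≤M = begin
  a (M (suc l) + j)                          ≡⟨ a-Ablock (suc (suc l)) bound ⟩
  nth (Ablock (suc (suc l))) (M (suc l) + j) ≡⟨ nth-Ablock-right l 1≤j ⟩
  nth (Ablock (suc l) ++ 1 ∷ []) j           ≡⟨ nth-++ˡ (Ablock (suc l)) _ j j≤length ⟩
  nth (Ablock (suc l)) j                     ≡⟨ sym (a-Ablock (suc l) j≤M) ⟩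
  a j                                        ∎
  where
  open ≡-Reasoning
  bound : M (suc l) + j ≤ M (suc (suc l))
  bound = subst (M (suc l) + j ≤_) (sym (M-suc (suc l))) (+-monoʳ-≤ (M (suc l)) (m≤n⇒m≤1+n j≤M))
  j≤length : j ≤ length (Ablock (suc l))
  j≤length = subst (j ≤_) (sym (length-Ablock (suc l))) j≤M

a-M : ∀ l → a (M (suc l) + suc (M (suc l))) ≡ 1
a-M l = begin
  a (M (suc l) + suc (M (suc l)))                          ≡⟨ a-Ablock (suc (suc l)) (≤-reflexive (sym (M-suc (suc l)))) ⟩
  nth (Ablock (suc (suc l))) (M (suc l) + suc (M (suc l))) ≡⟨ nth-Ablock-right l (s≤s z≤n) ⟩
  nth (B ++ 1 ∷ []) (suc (M (suc l)))                      ≡⟨ subst (λ L → nth (B ++ 1 ∷ []) L ≡ 1) length+1 (nth-++ʳ B (1 ∷ []) 1 (s≤s z≤n)) ⟩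
  1                                                        ∎
  where
  open ≡-Reasoning
  B = Ablock (suc l)
  length+1 : length B + 1 ≡ suc (M (suc l))
  length+1 = trans (cong (_+ 1) (length-Ablock (suc l))) (+-comm (M (suc l)) 1)

s-split : ∀ l r → r ≤ M l → s (M l + r) ≡ s (M l) + s r
s-split l zero    _   = trans (cong s (+-identityʳ (M l))) (sym (+-identityʳ (s (M l))))
s-split l (suc r) r<M = begin
  s (M l + suc r)                 ≡⟨ cong s (+-suc (M l) r) ⟩
  s (M l + r) + a (suc (M l + r)) ≡⟨ cong₂ _+_ (s-split l r (<⇒≤ r<M))
                                       (trans (cong a (sym (+-suc (M l) r))) (a-shift l (s≤s z≤n) r<M)) ⟩
  s (M l) + s r + a (suc r)       ≡⟨ +-assoc (s (M l)) (s r) (a (suc r)) ⟩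
  s (M l) + s (suc r)             ∎
  where open ≡-Reasoning

s-M : ∀ l → s (M (suc l)) ≡ M (suc l) + 2 ^ suc l * 2
s-M zero    = refl
s-M (suc l) = begin
  s (M (suc (suc l)))                 ≡⟨ cong s (M-suc (suc l)) ⟩
  s (M′ + suc M′)                     ≡⟨ cong s (+-suc M′ M′) ⟩
  s (M′ + M′) + a (suc (M′ + M′))     ≡⟨ cong₂ _+_ (s-split (suc l) M′ ≤-refl) (trans (cong a (sym (+-suc M′ M′))) (a-M l)) ⟩
  s M′ + s M′ + 1                     ≡⟨ cong (λ x → x + x + 1) (s-M l) ⟩
  (M′ + P * 2) + (M′ + P * 2) + 1     ≡⟨ solve 2 (λ m p → (m :+ p :* con 2) :+ (m :+ p :* con 2) :+ con 1
                                                      := (m :+ (con 1 :+ m)) :+ (con 2 :* p) :* con 2) refl M′ P ⟩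
  M′ + suc M′ + 2 ^ suc (suc l) * 2   ≡⟨ cong (_+ 2 ^ suc (suc l) * 2) (sym (M-suc (suc l))) ⟩
  M (suc (suc l)) + 2 ^ suc (suc l) * 2 ∎
  where
  open ≡-Reasoning
  M′ = M (suc l)
  P  = 2 ^ suc l

s-mono : ∀ {m n} → m ≤ n → s m ≤ s n
s-mono m≤n = go (≤⇒≤′ m≤n)
  where
  go : ∀ {m n} → m ≤′ n → s m ≤ s n
  go ≤′-refl        = ≤-refl
  go (≤′-step m≤′n) = ≤-trans (go m≤′n) (m≤m+n _ _)

M-lev-≤ : ∀ n j → M (lev n j) ≤ n
M-lev-≤ n zero    = z≤n
M-lev-≤ n (suc j) with M (suc j) ≤ᵇ n in M≤ᵇn
... | true  = ≤ᵇ⇒≤ (M (suc j)) n (subst T (sym M≤ᵇn) tt)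
... | false = M-lev-≤ n j

lev-maximal : ∀ n j {i} → i ≤ j → M i ≤ n → i ≤ lev n j
lev-maximal n zero    z≤n _ = z≤n
lev-maximal n (suc j) {i} i≤1+j Mi≤n with M (suc j) ≤ᵇ n in M≤ᵇn
... | true  = i≤1+j
... | false with m≤n⇒m<n∨m≡n i≤1+j
...   | inj₁ i<1+j = lev-maximal n j (≤-pred i<1+j) Mi≤n
...   | inj₂ refl  = ⊥-elim (subst T M≤ᵇn (≤⇒≤ᵇ Mi≤n))

M-ell-≤ : ∀ n → M (ell n) ≤ n
M-ell-≤ n = M-lev-≤ n n

ell-maximal : ∀ {i n} → M i ≤ n → i ≤ ell n
ell-maximal {i} {n} Mi≤n = lev-maximal n n (≤-trans (n≤M i) Mi≤n) Mi≤n

<-M-suc-ell : ∀ n → n < M (suc (ell n))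
<-M-suc-ell n = ≰⇒> (λ M≤n → 1+n≰n (ell-maximal M≤n))

ell-< : ∀ {n l} → n < M l → ell n < l
ell-< {n} n<M = ≰⇒> (λ l≤ell → <⇒≱ n<M (≤-trans (M-mono l≤ell) (M-ell-≤ n)))

ell-M+ : ∀ l {r} → r ≤ M l → ell (M l + r) ≡ l
ell-M+ l {r} r≤M = ≤-antisym
  (≤-pred (ell-< (subst (M l + r <_) (sym (M-suc l)) (+-monoʳ-< (M l) (s≤s r≤M)))))
  (ell-maximal (m≤m+n (M l) r))

ell-≤-log : ∀ h k → s k ≤ 2 ^ h → ell k ≤ h
ell-≤-log h k sk≤2^h = ≤-pred (ell-< (≰⇒> M≰k))
  where
  open ≤-Reasoning
  M≰k : M (suc h) ≰ k
  M≰k M≤k = <⇒≱ (begin-strict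
    2 ^ h                           <⟨ m<m+n (2 ^ h) (m^n>0 2 h) ⟩
    2 ^ h + 2 ^ h                   ≡⟨ cong (2 ^ h +_) (sym (+-identityʳ (2 ^ h))) ⟩
    2 ^ suc h                       ≤⟨ m≤m*n (2 ^ suc h) 2 ⟩
    2 ^ suc h * 2                   ≤⟨ m≤n+m (2 ^ suc h * 2) (M (suc h)) ⟩
    M (suc h) + 2 ^ suc h * 2       ≡⟨ sym (s-M h) ⟩
    s (M (suc h))                   ≤⟨ s-mono M≤k ⟩
    s k                             ∎) sk≤2^h

digitWeight : ℕ → (ℕ → ℕ) → ℕ
digitWeight zero    e = 0
digitWeight (suc H) e = digitWeight H e + 2 ^ suc H * (2 * e (suc H))

digitWeight-cong : ∀ H {e e′} → (∀ i → i ≤ H → e i ≡ e′ i) → digitWeight H e ≡ digitWeight H e′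
digitWeight-cong zero    _   = refl
digitWeight-cong (suc H) e≗e′ =
  cong₂ (λ w d → w + 2 ^ suc H * (2 * d))
        (digitWeight-cong H (λ i i≤H → e≗e′ i (m≤n⇒m≤1+n i≤H))) (e≗e′ (suc H) ≤-refl)

digitWeight-zeros : ∀ H → digitWeight H (λ _ → 0) ≡ 0
digitWeight-zeros zero    = refl
digitWeight-zeros (suc H) = cong₂ _+_ (digitWeight-zeros H) (*-zeroʳ (2 ^ suc H))

insertDigit : ℕ → ℕ → (ℕ → ℕ) → ℕ → ℕ
insertDigit l c e i = if i ≡ᵇ l then c else e i

insertDigit-≢ : ∀ {l i} c e → i ≢ l → insertDigit l c e i ≡ e i
insertDigit-≢ {l} {i} c e i≢l with i ≡ᵇ l in i≡ᵇl
... | true  = ⊥-elim (i≢l (≡ᵇ⇒≡ i l (subst T (sym i≡ᵇl) tt)))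
... | false = refl

insertDigit-self : ∀ l c e → insertDigit l c e l ≡ c
insertDigit-self l c e with l ≡ᵇ l | ≡⇒≡ᵇ l l refl
... | true  | _  = refl
... | false | ()

digitWeight-insert : ∀ H {l} c e → 1 ≤ l → l ≤ H → e l ≡ 0 →
  digitWeight H (insertDigit l c e) ≡ 2 ^ l * (2 * c) + digitWeight H e
digitWeight-insert zero    c e (s≤s _) () _
digitWeight-insert (suc H) {l} c e 1≤l l≤1+H el≡0 with m≤n⇒m<n∨m≡n l≤1+H
... | inj₁ l<1+H =
  trans (cong₂ (λ w d → w + 2 ^ suc H * (2 * d))
               (digitWeight-insert H c e 1≤l (≤-pred l<1+H) el≡0)
               (insertDigit-≢ c e (>⇒≢ l<1+H)))
        (+-assoc (2 ^ l * (2 * c)) (digitWeight H e) _)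
... | inj₂ refl = begin
  digitWeight H (insertDigit l c e) + 2 ^ l * (2 * insertDigit l c e l)
    ≡⟨ cong₂ (λ w d → w + 2 ^ l * (2 * d))
             (digitWeight-cong H (λ i i≤H → insertDigit-≢ c e (<⇒≢ (s≤s i≤H))))
             (insertDigit-self l c e) ⟩
  digitWeight H e + 2 ^ l * (2 * c)
    ≡⟨ +-comm (digitWeight H e) _ ⟩
  2 ^ l * (2 * c) + digitWeight H e
    ≡⟨ cong (2 ^ l * (2 * c) +_) (sym (+-identityʳ (digitWeight H e))) ⟩
  2 ^ l * (2 * c) + (digitWeight H e + 0)
    ≡⟨ cong (λ z → 2 ^ l * (2 * c) + (digitWeight H e + z)) (sym (*-zeroʳ (2 ^ l))) ⟩
  2 ^ l * (2 * c) + (digitWeight H e + 2 ^ l * (2 * 0))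
    ≡⟨ cong (λ d → 2 ^ l * (2 * c) + (digitWeight H e + 2 ^ l * (2 * d))) (sym el≡0) ⟩
  2 ^ l * (2 * c) + digitWeight (suc H) e ∎
  where open ≡-Reasoning

record DigitExpansion (n : ℕ) (e : ℕ → ℕ) : Set where
  field
    vanishes : ∀ i → ell n < i → e i ≡ 0
    balance  : ∀ H → ell n ≤ H → n + digitWeight H e ≡ s n

open DigitExpansion

digits-zero : DigitExpansion 0 (λ _ → 0)
digits-zero .vanishes _ _ = refl
digits-zero .balance  H _ = digitWeight-zeros H

digits-insert : ∀ l r e → r < M l → DigitExpansion r e → DigitExpansion (M l + r) (insertDigit l 1 e)
digits-insert (suc l) r e r<M de = record { vanishes = vanish ; balance = bal }
  where
  ell-r<l : ell r < suc l
  ell-r<l = ell-< r<M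
  el≡0 : e (suc l) ≡ 0
  el≡0 = de .vanishes (suc l) ell-r<l
  ell-Mr≡l : ell (M (suc l) + r) ≡ suc l
  ell-Mr≡l = ell-M+ (suc l) (<⇒≤ r<M)
  vanish : ∀ i → ell (M (suc l) + r) < i → insertDigit (suc l) 1 e i ≡ 0
  vanish i ell<i rewrite ell-Mr≡l =
    trans (insertDigit-≢ 1 e (>⇒≢ ell<i)) (de .vanishes i (<-trans ell-r<l ell<i))
  bal : ∀ H → ell (M (suc l) + r) ≤ H → M (suc l) + r + digitWeight H (insertDigit (suc l) 1 e) ≡ s (M (suc l) + r)
  bal H ell≤H rewrite ell-Mr≡l = begin
    M (suc l) + r + digitWeight H (insertDigit (suc l) 1 e)
      ≡⟨ cong (M (suc l) + r +_) (digitWeight-insert H 1 e (s≤s z≤n) ell≤H el≡0) ⟩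
    M (suc l) + r + (2 ^ suc l * 2 + digitWeight H e)
      ≡⟨ solve 4 (λ m x p w → m :+ x :+ (p :+ w) := (m :+ p) :+ (x :+ w)) refl (M (suc l)) r (2 ^ suc l * 2) (digitWeight H e) ⟩
    (M (suc l) + 2 ^ suc l * 2) + (r + digitWeight H e)
      ≡⟨ cong₂ _+_ (sym (s-M l)) (de .balance H (≤-trans (<⇒≤ ell-r<l) ell≤H)) ⟩
    s (M (suc l)) + s r
      ≡⟨ sym (s-split (suc l) r (<⇒≤ r<M)) ⟩
    s (M (suc l) + r) ∎
    where open ≡-Reasoning

digits-double : ∀ l → DigitExpansion (M (suc l) + M (suc l)) (insertDigit (suc l) 2 (λ _ → 0))
digits-double l = record { vanishes = vanish ; balance = bal }
  where
  ell-MM≡l : ell (M (suc l) + M (suc l)) ≡ suc l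
  ell-MM≡l = ell-M+ (suc l) ≤-refl
  vanish : ∀ i → ell (M (suc l) + M (suc l)) < i → insertDigit (suc l) 2 (λ _ → 0) i ≡ 0
  vanish i ell<i rewrite ell-MM≡l = insertDigit-≢ 2 (λ _ → 0) (>⇒≢ ell<i)
  bal : ∀ H → ell (M (suc l) + M (suc l)) ≤ H →
    M (suc l) + M (suc l) + digitWeight H (insertDigit (suc l) 2 (λ _ → 0)) ≡ s (M (suc l) + M (suc l))
  bal H ell≤H rewrite ell-MM≡l = begin
    M′ + M′ + digitWeight H (insertDigit (suc l) 2 (λ _ → 0))
      ≡⟨ cong (M′ + M′ +_) (digitWeight-insert H 2 (λ _ → 0) (s≤s z≤n) ell≤H refl) ⟩
    M′ + M′ + (P * 4 + digitWeight H (λ _ → 0))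
      ≡⟨ cong (λ w → M′ + M′ + (P * 4 + w)) (digitWeight-zeros H) ⟩
    M′ + M′ + (P * 4 + 0)
      ≡⟨ solve 2 (λ m p → m :+ m :+ (p :* con 4 :+ con 0) := (m :+ p :* con 2) :+ (m :+ p :* con 2)) refl M′ P ⟩
    (M′ + P * 2) + (M′ + P * 2)
      ≡⟨ cong (λ x → x + x) (sym (s-M l)) ⟩
    s M′ + s M′
      ≡⟨ sym (s-split (suc l) M′ ≤-refl) ⟩
    s (M′ + M′) ∎
    where
    open ≡-Reasoning
    M′ = M (suc l)
    P  = 2 ^ suc l

-- The body of epsF for n = M_l + r, where e are the digits of r.
greedyStep : ℕ → ℕ → (ℕ → ℕ) → ℕ → ℕ
greedyStep l r e i =
  if r ≡ᵇ 0 then insertDigit l 1 (λ _ → 0) i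
  else if r ≡ᵇ M l then insertDigit l 2 (λ _ → 0) i
  else insertDigit l 1 e i

digits-greedyStep : ∀ l r e → 1 ≤ l → r ≤ M l → DigitExpansion r e →
  DigitExpansion (M l + r) (greedyStep l r e)
digits-greedyStep (suc l) r e _ r≤M de with r ≡ᵇ 0 in r≡ᵇ0 | r ≡ᵇ M (suc l) in r≡ᵇM
... | true | _ rewrite ≡ᵇ⇒≡ r 0 (subst T (sym r≡ᵇ0) tt) =
  digits-insert (suc l) 0 (λ _ → 0) (M-mono {1} {suc l} (s≤s z≤n)) digits-zero
... | false | true rewrite ≡ᵇ⇒≡ r (M (suc l)) (subst T (sym r≡ᵇM) tt) = digits-double l
... | false | false = digits-insert (suc l) r e (≤∧≢⇒< r≤M (λ r≡M → subst T r≡ᵇM (≡⇒≡ᵇ r (M (suc l)) r≡M))) de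

epsF-digits : ∀ f n → n ≤ f → DigitExpansion n (epsF f n)
epsF-digits zero    zero    _         = digits-zero
epsF-digits (suc f) zero    _         = digits-zero
epsF-digits (suc f) (suc m) (s≤s m≤f) =
  subst (λ n → DigitExpansion n (epsF (suc f) (suc m))) Ml+r≡n
        (digits-greedyStep l r (epsF f r) 1≤l r≤M (epsF-digits f r r≤f))
  where
  l = ell (suc m)
  r = suc m ∸ M l
  1≤l : 1 ≤ l
  1≤l = ell-maximal {1} {suc m} (s≤s z≤n)
  Ml+r≡n : M l + r ≡ suc m
  Ml+r≡n = m+[n∸m]≡n (M-ell-≤ (suc m))
  r≤M : r ≤ M l
  r≤M = ≤-pred (+-cancelˡ-< (M l) r (suc (M l))
          (subst₂ _<_ (sym Ml+r≡n) (M-suc l) (<-M-suc-ell (suc m))))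
  r≤f : r ≤ f
  r≤f = ≤-trans (∸-monoʳ-≤ (suc m) (M-mono 1≤l)) m≤f

s≡k+digitWeight : ∀ h k → s k ≤ 2 ^ h → s k ≡ k + digitWeight h (eps k)
s≡k+digitWeight h k sk≤2^h = sym (epsF-digits k k ≤-refl .balance h (ell-≤-log h k sk≤2^h))

sumFin-cong : ∀ n {g g′ : Fin n → ℕ} → (∀ i → g i ≡ g′ i) → sumFin n g ≡ sumFin n g′
sumFin-cong zero    _    = refl
sumFin-cong (suc n) g≗g′ = cong₂ _+_ (g≗g′ Fin.zero) (sumFin-cong n (λ i → g≗g′ (Fin.suc i)))

sumFin-const : ∀ n c → sumFin n (λ _ → c) ≡ n * c
sumFin-const zero    c = refl
sumFin-const (suc n) c = cong (c +_) (sumFin-const n c)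

sumFin-init-last : ∀ n (g : Fin (suc n) → ℕ) → sumFin (suc n) g ≡ sumFin n (λ i → g (inject₁ i)) + g (fromℕ n)
sumFin-init-last zero    g = +-comm (g Fin.zero) 0
sumFin-init-last (suc n) g =
  trans (cong (g Fin.zero +_) (sumFin-init-last n (λ i → g (Fin.suc i)))) (sym (+-assoc (g Fin.zero) _ _))

sumFin-weightedSum : ∀ h lv → sumFin (suc h) (λ i → 2 ^ toℕ i * lv (toℕ i)) ≡ weightedSum h lv
sumFin-weightedSum zero    lv = trans (+-identityʳ _) (+-identityʳ (lv 0))
sumFin-weightedSum (suc h) lv = begin
  sumFin (suc (suc h)) (g ∘ toℕ)
    ≡⟨ sumFin-init-last (suc h) (g ∘ toℕ) ⟩
  sumFin (suc h) (λ i → g (toℕ (inject₁ i))) + g (toℕ (fromℕ (suc h)))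
    ≡⟨ cong₂ _+_ (sumFin-cong (suc h) (λ i → cong g (toℕ-inject₁ i))) (cong g (toℕ-fromℕ (suc h))) ⟩
  sumFin (suc h) (g ∘ toℕ) + g (suc h)
    ≡⟨ cong (_+ g (suc h)) (sumFin-weightedSum h lv) ⟩
  weightedSum (suc h) lv ∎
  where
  open ≡-Reasoning
  g : ℕ → ℕ
  g i = 2 ^ i * lv i

total-symmetric : ∀ h lv → total h (symmetric h lv) ≡ weightedSum h lv
total-symmetric h lv =
  trans (sumFin-cong (suc h) (λ i → sumFin-const (2 ^ toℕ i) (lv (toℕ i)))) (sumFin-weightedSum h lv)

weightedSum-fhkLevels : ∀ h′ k h → weightedSum h (fhkLevels h′ k) ≡ (2 ^ h′ ∸ s k) + digitWeight h (eps k)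
weightedSum-fhkLevels h′ k zero    = sym (+-identityʳ _)
weightedSum-fhkLevels h′ k (suc h) =
  trans (cong (_+ 2 ^ suc h * (2 * eps k (suc h))) (weightedSum-fhkLevels h′ k h))
        (+-assoc (2 ^ h′ ∸ s k) (digitWeight h (eps k)) _)

[m∸[n+o]]+o≡m∸n : ∀ m n o → n + o ≤ m → (m ∸ (n + o)) + o ≡ m ∸ n
[m∸[n+o]]+o≡m∸n m n o n+o≤m =
  trans (cong (_+ o) (sym (∸-+-assoc m n o)))
        (m∸n+n≡m (subst (_≤ m ∸ n) (m+n∸m≡n n o) (∸-monoˡ-≤ n n+o≤m)))

lemma3p2 : (h k : ℕ) → h ≥ 1 → s k ≤ 2 ^ h →
    (total h (fhk h k) ≡ weightedSum h (fhkLevels h k)) × (total h (fhk h k) ≡ 2 ^ h ∸ k)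
lemma3p2 h k _ sk≤2^h = total-symmetric h (fhkLevels h k) , (begin
  total h (fhk h k)                ≡⟨ total-symmetric h (fhkLevels h k) ⟩
  weightedSum h (fhkLevels h k)    ≡⟨ weightedSum-fhkLevels h k h ⟩
  (2 ^ h ∸ s k) + W                ≡⟨ cong (λ x → (2 ^ h ∸ x) + W) sk≡k+W ⟩
  (2 ^ h ∸ (k + W)) + W            ≡⟨ [m∸[n+o]]+o≡m∸n (2 ^ h) k W (subst (_≤ 2 ^ h) sk≡k+W sk≤2^h) ⟩
  2 ^ h ∸ k                        ∎)
  where
  open ≡-Reasoning
  W = digitWeight h (eps k)
  sk≡k+W : s k ≡ k + W
  sk≡k+W = s≡k+digitWeight h k sk≤2^h
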